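{- Let $m\geq 3$ be an odd integer and $p$ an odd prime such that $2m^p-1$ is square-free. Then neither $2^{\frac{p-1}{2}}(1+\sqrt{1-2m^p})$ nor $-2^{\frac{p-1}{2}}(1+\sqrt{1-2m^p})$ is a $p$-th power of an element of the ring of integers of $\mathbb{Q}(\sqrt{1-2m^p})$. -}

module Defs where

open import Data.Nat as ℕ using (ℕ; zero; suc)
open import Data.Nat.Divisibility using (_∣_)
open import Data.Integer as ℤ using (ℤ)
open import Data.Rational as ℚ using (ℚ; 0ℚ; 1ℚ)
open import Data.List using (List; []; _∷_; length)
open import Data.Product using (Σ; _×_; _,_; ∃)
open import Relation.Binary.PropositionalEquality using (_≡_)

ℤ→ℚ : ℤ → ℚ
ℤ→ℚ z = z ℚ./ 1

-- Elements of the quadratic field ℚ(√d): the pair (a , b) stands for a + b√d.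
-- (For d not a perfect square, e.g. d < 0, this is the field ℚ(√d).)
QF : Set
QF = ℚ × ℚ

module QuadField (d : ℤ) where
  D : ℚ
  D = ℤ→ℚ d

  embed : ℤ → QF
  embed z = (ℤ→ℚ z , 0ℚ)

  zeroQF : QF
  zeroQF = (0ℚ , 0ℚ)

  oneQF : QF
  oneQF = (1ℚ , 0ℚ)

  sqrtD : QF
  sqrtD = (0ℚ , 1ℚ)

  _⊕_ : QF → QF → QF
  (a , b) ⊕ (c , e) = (a ℚ.+ c , b ℚ.+ e)

  _⊗_ : QF → QF → QF
  (a , b) ⊗ (c , e) = ((a ℚ.* c) ℚ.+ (D ℚ.* (b ℚ.* e)) , (a ℚ.* e) ℚ.+ (b ℚ.* c))

  ⊖_ : QF → QF
  ⊖ (a , b) = (ℚ.- a , ℚ.- b)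

  _^ᴷ_ : QF → ℕ → QF
  x ^ᴷ zero = oneQF
  x ^ᴷ suc n = x ⊗ (x ^ᴷ n)

  evalPoly : List ℤ → QF → QF
  evalPoly [] x = zeroQF
  evalPoly (c ∷ cs) x = embed c ⊕ (x ⊗ evalPoly cs x)

  -- x is an algebraic integer: a root of a monic polynomial with integer
  -- coefficients  X^k + c_{k-1} X^{k-1} + … + c₀.
  IsAlgebraicInteger : QF → Set
  IsAlgebraicInteger x = Σ (List ℤ) λ cs → ((x ^ᴷ length cs) ⊕ evalPoly cs x) ≡ zeroQF

  IsPthPowerInOK : ℕ → QF → Set
  IsPthPowerInOK p x = Σ QF λ y → IsAlgebraicInteger y × ((y ^ᴷ p) ≡ x)

SquareFree : ℕ → Set
SquareFree n = ∀ k → (k ℕ.* k) ∣ n → k ≡ 1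

-- Put w = 2mᵖ − 1, so d = 1 − 2mᵖ = −w, and k = (p − 1)/2. The norm of ±2ᵏ(1 + √d) is
-- 2²ᵏ(1 − d) = (2m)ᵖ, and norms a² + w b² are non-negative, so a p-th root y = a + b√d has
-- norm 2m; it has b ≠ 0 because rationals have rational powers. An algebraic integer of
-- integral norm n with b ≠ 0 has integral trace t = 2a: reducing its monic equation modulo
-- y² = t y − n leaves a rational-coefficient identity whose leading term, after clearing the
-- denominator V of t = U/V, gives V ∣ Uᵏ⁻¹, hence V = 1. Now w (2b)² = 8m − (2a)², and as w is
-- square-free the rational 2b is an integer, so w ≤ 8m, whereas w > 8m when m, p ≥ 3.
module Submission where

open import Defs
open import Algebra.Bundles using (CommutativeRing)
open import Data.Empty using (⊥-elim)
open import Data.Integer as ℤ using (ℤ; +_; -[1+_])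
import Data.Integer.Divisibility.Signed as ℤ∣
import Data.Integer.Properties as ℤP
import Data.Integer.Solver
open import Data.List using (List; []; _∷_; length)
open import Data.Nat as ℕ using (ℕ; zero; suc; _≤_; _<_; _∸_; _^_)
import Data.Nat.Coprimality as Cop
open import Data.Nat.Divisibility as ℕ∣ using (_∣_; divides)
open import Data.Nat.DivMod using (_/_; _%_)
import Data.Nat.DivMod as ℕDM
open import Data.Nat.Primality using (Prime; prime⇒nonZero; prime⇒nonTrivial)
import Data.Nat.Properties as ℕP
import Data.Nat.Solver
open import Data.Product using (Σ; _×_; _,_; proj₁; proj₂)
open import Data.Rational as ℚ using (ℚ; mkℚ; 0ℚ; 1ℚ; ↥_; ↧_)
import Data.Rational.Properties as ℚP
import Data.Rational.Solver
import Data.Rational.Unnormalised as ℚᵘ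
import Data.Rational.Unnormalised.Properties as ℚᵘP
open import Data.Sum using (inj₁; inj₂)
open import Relation.Binary.Definitions using (tri<; tri≈; tri>)
open import Relation.Binary.PropositionalEquality
open import Relation.Nullary using (¬_; yes; no)

module ℤS = Data.Integer.Solver.+-*-Solver
module ℚS = Data.Rational.Solver.+-*-Solver
module ℕS = Data.Nat.Solver.+-*-Solver

open import Algebra.Properties.CommutativeSemiring.Exp
  (CommutativeRing.commutativeSemiring ℚP.+-*-commutativeRing)
  using (^-distrib-*; ^-homo-*)
  renaming (_^_ to _^ᵠ_)

-- Unlike `ℤ→ℚ`, which normalises, `fromℤ z` has numerator z by definition.
fromℤ : ℤ → ℚ
fromℤ z = mkℚ z 0 (Cop.sym (Cop.1-coprimeTo ℤ.∣ z ∣))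

ℤ→ℚ≡fromℤ : ∀ z → ℤ→ℚ z ≡ fromℤ z
ℤ→ℚ≡fromℤ z = ℚP.↥p/↧p≡p (fromℤ z)

fromℤ-injective : ∀ {x y} → fromℤ x ≡ fromℤ y → x ≡ y
fromℤ-injective = cong ↥_

fromℤ-homo-+ : ∀ x y → fromℤ (x ℤ.+ y) ≡ fromℤ x ℚ.+ fromℤ y
fromℤ-homo-+ x y = ℚP.toℚᵘ-injective
  (ℚᵘP.≃-trans (ℚᵘ.*≡* eq) (ℚᵘP.≃-sym (ℚP.toℚᵘ-homo-+ (fromℤ x) (fromℤ y))))
  where
  open ℤS
  eq : (x ℤ.+ y) ℤ.* + 1 ≡ (x ℤ.* + 1 ℤ.+ y ℤ.* + 1) ℤ.* + 1
  eq = solve 2 (λ x y → (x :+ y) :* con (+ 1) := (x :* con (+ 1) :+ y :* con (+ 1)) :* con (+ 1)) refl x y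

fromℤ-homo-* : ∀ x y → fromℤ (x ℤ.* y) ≡ fromℤ x ℚ.* fromℤ y
fromℤ-homo-* x y = ℚP.toℚᵘ-injective
  (ℚᵘP.≃-trans (ℚᵘ.*≡* refl) (ℚᵘP.≃-sym (ℚP.toℚᵘ-homo-* (fromℤ x) (fromℤ y))))

fromℤ-homo‿- : ∀ x → fromℤ (ℤ.- x) ≡ ℚ.- fromℤ x
fromℤ-homo‿- x = ℚP.toℚᵘ-injective
  (ℚᵘP.≃-trans (ℚᵘ.*≡* refl) (ℚᵘP.≃-sym (ℚP.toℚᵘ-homo‿- (fromℤ x))))

fromℤ-homo-- : ∀ x y → fromℤ (x ℤ.- y) ≡ fromℤ x ℚ.- fromℤ y
fromℤ-homo-- x y = trans (fromℤ-homo-+ x (ℤ.- y)) (cong (fromℤ x ℚ.+_) (fromℤ-homo‿- y))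

fromℕ-homo-* : ∀ x y → fromℤ (+ (x ℕ.* y)) ≡ fromℤ (+ x) ℚ.* fromℤ (+ y)
fromℕ-homo-* x y = trans (cong fromℤ (ℤP.pos-* x y)) (fromℤ-homo-* (+ x) (+ y))

fromℕ-homo-^ : ∀ x k → fromℤ (+ (x ^ k)) ≡ fromℤ (+ x) ^ᵠ k
fromℕ-homo-^ x zero = refl
fromℕ-homo-^ x (suc k) = trans (fromℕ-homo-* x (x ^ k)) (cong (fromℤ (+ x) ℚ.*_) (fromℕ-homo-^ x k))

r*↧r≡↥r : ∀ r → r ℚ.* fromℤ (↧ r) ≡ fromℤ (↥ r)
r*↧r≡↥r r@(mkℚ u _ _) = ℚP.toℚᵘ-injective
  (ℚᵘP.≃-trans (ℚP.toℚᵘ-homo-* r (fromℤ (↧ r))) (ℚᵘ.*≡* eq))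
  where
  open ℤS
  eq : (u ℤ.* ↧ r) ℤ.* + 1 ≡ u ℤ.* (↧ r ℤ.* + 1)
  eq = solve 2 (λ u v → (u :* v) :* con (+ 1) := u :* (v :* con (+ 1))) refl u (↧ r)

x*y≡0⇒y≡0 : ∀ {x y} → x ≢ 0ℚ → x ℚ.* y ≡ 0ℚ → y ≡ 0ℚ
x*y≡0⇒y≡0 {x} {y} x≢0 xy≡0 = begin
  y                    ≡⟨ sym (ℚP.*-identityˡ y) ⟩
  1ℚ ℚ.* y             ≡⟨ cong (ℚ._* y) (sym (ℚP.*-inverseˡ x)) ⟩
  (ℚ.1/ x ℚ.* x) ℚ.* y ≡⟨ ℚP.*-assoc (ℚ.1/ x) x y ⟩
  ℚ.1/ x ℚ.* (x ℚ.* y) ≡⟨ cong (ℚ.1/ x ℚ.*_) xy≡0 ⟩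
  ℚ.1/ x ℚ.* 0ℚ        ≡⟨ ℚP.*-zeroʳ (ℚ.1/ x) ⟩
  0ℚ                   ∎
  where
  open ≡-Reasoning
  instance
    _ : ℚ.NonZero x
    _ = ℚ.≢-nonZero x≢0

0≤x*y : ∀ {x y} → 0ℚ ℚ.≤ x → 0ℚ ℚ.≤ y → 0ℚ ℚ.≤ x ℚ.* y
0≤x*y {x} {y} 0≤x 0≤y = ℚP.nonNegative⁻¹ (x ℚ.* y)
  {{ℚP.nonNeg*nonNeg⇒nonNeg x {{ℚ.nonNegative 0≤x}} y {{ℚ.nonNegative 0≤y}}}}

0≤x*x : ∀ x → 0ℚ ℚ.≤ x ℚ.* x
0≤x*x x with ℚP.≤-total 0ℚ x
... | inj₁ 0≤x = 0≤x*y 0≤x 0≤x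
... | inj₂ x≤0 = ℚP.nonNegative⁻¹ (x ℚ.* x)
  {{ℚP.nonPos*nonPos⇒nonPos x {{ℚ.nonPositive x≤0}} x {{ℚ.nonPositive x≤0}}}}

0≤x^n : ∀ {x} n → 0ℚ ℚ.≤ x → 0ℚ ℚ.≤ x ^ᵠ n
0≤x^n zero    _   = ℚP.nonNegative⁻¹ 1ℚ
0≤x^n (suc n) 0≤x = 0≤x*y 0≤x (0≤x^n n 0≤x)

^-monoˡ-<-nonNeg : ∀ n {x y} → 0ℚ ℚ.≤ x → x ℚ.< y → x ^ᵠ suc n ℚ.< y ^ᵠ suc n
^-monoˡ-<-nonNeg zero {x} {y} _ x<y =
  subst₂ ℚ._<_ (sym (ℚP.*-identityʳ x)) (sym (ℚP.*-identityʳ y)) x<y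
^-monoˡ-<-nonNeg (suc n) {x} {y} 0≤x x<y = ℚP.≤-<-trans
  (ℚP.*-monoˡ-≤-nonNeg x {{ℚ.nonNegative 0≤x}} (ℚP.<⇒≤ xⁿ<yⁿ))
  (ℚP.*-monoˡ-<-pos (y ^ᵠ suc n) {{ℚ.positive (ℚP.≤-<-trans (0≤x^n (suc n) 0≤x) xⁿ<yⁿ)}} x<y)
  where
  xⁿ<yⁿ : x ^ᵠ suc n ℚ.< y ^ᵠ suc n
  xⁿ<yⁿ = ^-monoˡ-<-nonNeg n 0≤x x<y

^-cancelˡ-≡-nonNeg : ∀ n {x y} → 0ℚ ℚ.≤ x → 0ℚ ℚ.≤ y → x ^ᵠ suc n ≡ y ^ᵠ suc n → x ≡ y
^-cancelˡ-≡-nonNeg n {x} {y} 0≤x 0≤y xⁿ≡yⁿ with ℚP.<-cmp x y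
... | tri< x<y _ _ = ⊥-elim (ℚP.<-irrefl xⁿ≡yⁿ (^-monoˡ-<-nonNeg n 0≤x x<y))
... | tri≈ _ x≡y _ = x≡y
... | tri> _ _ y<x = ⊥-elim (ℚP.<-irrefl (sym xⁿ≡yⁿ) (^-monoˡ-<-nonNeg n 0≤y y<x))

coprime-*ʳ : ∀ {a b c} → Cop.Coprime a b → Cop.Coprime a c → Cop.Coprime a (b ℕ.* c)
coprime-*ʳ {a} {b} cop[a,b] cop[a,c] {i} (i∣a , i∣bc) =
  cop[a,c] (i∣a , Cop.coprime-divisor cop[i,b] i∣bc)
  where
  cop[i,b] : Cop.Coprime i b
  cop[i,b] (j∣i , j∣b) = cop[a,b] (ℕ∣.∣-trans j∣i i∣a , j∣b)

coprime-^ʳ : ∀ {a b} k → Cop.Coprime a b → Cop.Coprime a (b ^ k)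
coprime-^ʳ zero    _        = Cop.sym (Cop.1-coprimeTo _)
coprime-^ʳ (suc k) cop[a,b] = coprime-*ʳ cop[a,b] (coprime-^ʳ k cop[a,b])

∣i^n∣≡∣i∣^n : ∀ i n → ℤ.∣ i ℤ.^ n ∣ ≡ ℤ.∣ i ∣ ^ n
∣i^n∣≡∣i∣^n i zero    = refl
∣i^n∣≡∣i∣^n i (suc n) = trans (ℤP.abs-* i (i ℤ.^ n)) (cong (ℤ.∣ i ∣ ℕ.*_) (∣i^n∣≡∣i∣^n i n))

↧ₙ≡1⇒integral : ∀ r → ℚ.↧ₙ r ≡ 1 → r ≡ fromℤ (↥ r)
↧ₙ≡1⇒integral (mkℚ _ zero _) _ = refl

↧∣↥^n⇒integral : ∀ r n → ↧ r ℤ∣.∣ ↥ r ℤ.^ n → r ≡ fromℤ (↥ r)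
↧∣↥^n⇒integral r@(mkℚ _ _ cop) n ↧∣↥ⁿ = ↧ₙ≡1⇒integral r
  (ℕ∣.∣1⇒≡1 (Cop.coprime-divisor (coprime-^ʳ n (Cop.sym (Cop.recompute cop))) ↧∣∣↥∣ⁿ*1))
  where
  ↧∣∣↥∣ⁿ*1 : ℚ.↧ₙ r ∣ ℤ.∣ ↥ r ∣ ^ n ℕ.* 1
  ↧∣∣↥∣ⁿ*1 = subst (ℚ.↧ₙ r ∣_) (trans (∣i^n∣≡∣i∣^n (↥ r) n) (sym (ℕP.*-identityʳ _))) (ℤ∣.∣⇒∣ᵤ ↧∣↥ⁿ)

square-∣∣ : ∀ z → z ℤ.* z ≡ + (ℤ.∣ z ∣ ℕ.* ℤ.∣ z ∣)
square-∣∣ (+ x)    = sym (ℤP.pos-* x x)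
square-∣∣ -[1+ x ] = refl

-- Writing s = g / h in lowest terms, w g² = K h² forces h² ∣ w.
squareFree*square⇒integral : ∀ {w} (s : ℚ) {K} → SquareFree w
  → fromℤ (+ w) ℚ.* (s ℚ.* s) ≡ fromℤ K → s ≡ fromℤ (↥ s)
squareFree*square⇒integral {w} s@(mkℚ _ _ cop) {K} sf ws²≡K = ↧ₙ≡1⇒integral s (sf h h²∣w)
  where
  g = ↥ s
  h = ℚ.↧ₙ s
  H = + h
  wg²≡Kh² : + w ℤ.* (g ℤ.* g) ≡ K ℤ.* (H ℤ.* H)
  wg²≡Kh² = fromℤ-injective (begin
    fromℤ (+ w ℤ.* (g ℤ.* g))
      ≡⟨ trans (fromℤ-homo-* (+ w) (g ℤ.* g)) (cong (fromℤ (+ w) ℚ.*_) (fromℤ-homo-* g g)) ⟩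
    fromℤ (+ w) ℚ.* (fromℤ g ℚ.* fromℤ g)
      ≡⟨ cong (λ x → fromℤ (+ w) ℚ.* (x ℚ.* x)) (sym (r*↧r≡↥r s)) ⟩
    fromℤ (+ w) ℚ.* ((s ℚ.* fromℤ H) ℚ.* (s ℚ.* fromℤ H))
      ≡⟨ ℚS.solve 3 (λ w s h → w ℚS.:* ((s ℚS.:* h) ℚS.:* (s ℚS.:* h)) ℚS.:= (w ℚS.:* (s ℚS.:* s)) ℚS.:* (h ℚS.:* h))
           refl (fromℤ (+ w)) s (fromℤ H) ⟩
    (fromℤ (+ w) ℚ.* (s ℚ.* s)) ℚ.* (fromℤ H ℚ.* fromℤ H)
      ≡⟨ cong₂ ℚ._*_ ws²≡K (sym (fromℤ-homo-* H H)) ⟩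
    fromℤ K ℚ.* fromℤ (H ℤ.* H)
      ≡⟨ sym (fromℤ-homo-* K (H ℤ.* H)) ⟩
    fromℤ (K ℤ.* (H ℤ.* H)) ∎)
    where open ≡-Reasoning
  |g| = ℤ.∣ g ∣
  |g|²w≡|K|h² : (|g| ℕ.* |g|) ℕ.* w ≡ ℤ.∣ K ∣ ℕ.* (h ℕ.* h)
  |g|²w≡|K|h² = begin
    (|g| ℕ.* |g|) ℕ.* w       ≡⟨ ℕP.*-comm (|g| ℕ.* |g|) w ⟩
    w ℕ.* (|g| ℕ.* |g|)       ≡⟨ cong (w ℕ.*_) (sym (ℤP.abs-* g g)) ⟩
    w ℕ.* ℤ.∣ g ℤ.* g ∣       ≡⟨ sym (ℤP.abs-* (+ w) (g ℤ.* g)) ⟩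
    ℤ.∣ + w ℤ.* (g ℤ.* g) ∣   ≡⟨ cong ℤ.∣_∣ wg²≡Kh² ⟩
    ℤ.∣ K ℤ.* (H ℤ.* H) ∣     ≡⟨ ℤP.abs-* K (H ℤ.* H) ⟩
    ℤ.∣ K ∣ ℕ.* (h ℕ.* h)     ∎
    where open ≡-Reasoning
  cop[h,|g|] : Cop.Coprime h |g|
  cop[h,|g|] = Cop.sym (Cop.recompute cop)
  cop[h²,|g|] : Cop.Coprime (h ℕ.* h) |g|
  cop[h²,|g|] = Cop.sym (coprime-*ʳ (Cop.sym cop[h,|g|]) (Cop.sym cop[h,|g|]))
  h²∣w : h ℕ.* h ∣ w
  h²∣w = Cop.coprime-divisor (coprime-*ʳ cop[h²,|g|] cop[h²,|g|]) (divides ℤ.∣ K ∣ |g|²w≡|K|h²)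

squareFree-bound : ∀ {w K} (s : ℚ) (U : ℤ) → SquareFree w → s ≢ 0ℚ
  → fromℤ (+ w) ℚ.* (s ℚ.* s) ℚ.+ fromℤ U ℚ.* fromℤ U ≡ fromℤ (+ K) → w ≤ K
squareFree-bound {w} {K} s U sf s≢0 ws²+U²≡K =
  ℕP.≤-trans (ℕP.m≤m*n w (|g| ℕ.* |g|) {{ℕP.m*n≢0 |g| |g| {{|g|≢0}} {{|g|≢0}}}})
             (ℕP.≤-trans (ℕP.m≤m+n (w ℕ.* (|g| ℕ.* |g|)) (|U| ℕ.* |U|)) (ℕP.≤-reflexive (ℤP.+-injective w|g|²+|U|²≡K)))
  where
  open ≡-Reasoning
  g = ↥ s
  |g| = ℤ.∣ g ∣
  |U| = ℤ.∣ U ∣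
  s≡g : s ≡ fromℤ g
  s≡g = squareFree*square⇒integral s sf (begin
    fromℤ (+ w) ℚ.* (s ℚ.* s)
      ≡⟨ ℚS.solve 2 (λ x u → x ℚS.:= (x ℚS.:+ u) ℚS.:- u) refl (fromℤ (+ w) ℚ.* (s ℚ.* s)) (fromℤ U ℚ.* fromℤ U) ⟩
    (fromℤ (+ w) ℚ.* (s ℚ.* s) ℚ.+ fromℤ U ℚ.* fromℤ U) ℚ.- fromℤ U ℚ.* fromℤ U
      ≡⟨ cong₂ ℚ._-_ ws²+U²≡K (sym (fromℤ-homo-* U U)) ⟩
    fromℤ (+ K) ℚ.- fromℤ (U ℤ.* U)
      ≡⟨ sym (fromℤ-homo-- (+ K) (U ℤ.* U)) ⟩
    fromℤ (+ K ℤ.- U ℤ.* U) ∎)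
  |g|≢0 : ℕ.NonZero |g|
  |g|≢0 = ℕ.≢-nonZero λ |g|≡0 → s≢0 (trans s≡g (cong fromℤ (ℤP.∣i∣≡0⇒i≡0 |g|≡0)))
  w|g|²+|U|²≡K : + (w ℕ.* (|g| ℕ.* |g|) ℕ.+ |U| ℕ.* |U|) ≡ + K
  w|g|²+|U|²≡K = begin
    + (w ℕ.* (|g| ℕ.* |g|) ℕ.+ |U| ℕ.* |U|)
      ≡⟨ ℤP.pos-+ (w ℕ.* (|g| ℕ.* |g|)) (|U| ℕ.* |U|) ⟩
    + (w ℕ.* (|g| ℕ.* |g|)) ℤ.+ + (|U| ℕ.* |U|)
      ≡⟨ cong₂ ℤ._+_ (trans (ℤP.pos-* w (|g| ℕ.* |g|)) (cong (+ w ℤ.*_) (sym (square-∣∣ g)))) (sym (square-∣∣ U)) ⟩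
    + w ℤ.* (g ℤ.* g) ℤ.+ U ℤ.* U
      ≡⟨ fromℤ-injective (begin
           fromℤ (+ w ℤ.* (g ℤ.* g) ℤ.+ U ℤ.* U)
             ≡⟨ fromℤ-homo-+ (+ w ℤ.* (g ℤ.* g)) (U ℤ.* U) ⟩
           fromℤ (+ w ℤ.* (g ℤ.* g)) ℚ.+ fromℤ (U ℤ.* U)
             ≡⟨ cong₂ ℚ._+_ (trans (fromℤ-homo-* (+ w) (g ℤ.* g)) (cong (fromℤ (+ w) ℚ.*_) (fromℤ-homo-* g g))) (fromℤ-homo-* U U) ⟩
           fromℤ (+ w) ℚ.* (fromℤ g ℚ.* fromℤ g) ℚ.+ fromℤ U ℚ.* fromℤ U
             ≡⟨ cong (λ x → fromℤ (+ w) ℚ.* (x ℚ.* x) ℚ.+ fromℤ U ℚ.* fromℤ U) (sym s≡g) ⟩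
           fromℤ (+ w) ℚ.* (s ℚ.* s) ℚ.+ fromℤ U ℚ.* fromℤ U
             ≡⟨ ws²+U²≡K ⟩
           fromℤ (+ K) ∎) ⟩
    + K ∎

module QuadraticField (d : ℤ) where
  open QuadField d
  open ℚS

  norm : QF → ℚ
  norm (a , b) = a ℚ.* a ℚ.- D ℚ.* (b ℚ.* b)

  norm-homo-⊗ : ∀ x y → norm (x ⊗ y) ≡ norm x ℚ.* norm y
  norm-homo-⊗ (a , b) (c , e) = solve 5
    (λ a b c e D → (a :* c :+ D :* (b :* e)) :* (a :* c :+ D :* (b :* e)) :- D :* ((a :* e :+ b :* c) :* (a :* e :+ b :* c))
                := (a :* a :- D :* (b :* b)) :* (c :* c :- D :* (e :* e)))
    refl a b c e D

  norm-homo-^ᴷ : ∀ x k → norm (x ^ᴷ k) ≡ norm x ^ᵠ k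
  norm-homo-^ᴷ x zero    = solve 1 (λ D → con 1ℚ :* con 1ℚ :- D :* (con 0ℚ :* con 0ℚ) := con 1ℚ) refl D
  norm-homo-^ᴷ x (suc k) = trans (norm-homo-⊗ x (x ^ᴷ k)) (cong (norm x ℚ.*_) (norm-homo-^ᴷ x k))

  norm-⊖ : ∀ x → norm (⊖ x) ≡ norm x
  norm-⊖ (a , b) = solve 3 (λ a b D → (:- a) :* (:- a) :- D :* ((:- b) :* (:- b)) := a :* a :- D :* (b :* b)) refl a b D

  norm-nonNeg : D ℚ.≤ 0ℚ → ∀ x → 0ℚ ℚ.≤ norm x
  norm-nonNeg D≤0 (a , b) = subst (0ℚ ℚ.≤_)
    (solve 3 (λ a b D → a :* a :+ (:- D) :* (b :* b) := a :* a :- D :* (b :* b)) refl a b D)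
    (ℚP.+-mono-≤ (0≤x*x a) (0≤x*y (ℚP.neg-antimono-≤ D≤0) (0≤x*x b)))

  rational-^ᴷ : ∀ a k → proj₂ ((a , 0ℚ) ^ᴷ k) ≡ 0ℚ
  rational-^ᴷ a zero    = refl
  rational-^ᴷ a (suc k) = trans (cong (λ z → a ℚ.* z ℚ.+ 0ℚ ℚ.* proj₁ ((a , 0ℚ) ^ᴷ k)) (rational-^ᴷ a k))
    (solve 2 (λ a x → a :* con 0ℚ :+ con 0ℚ :* x := con 0ℚ) refl a (proj₁ ((a , 0ℚ) ^ᴷ k)))

  embed⊗[1+√d] : ∀ z → embed z ⊗ (oneQF ⊕ sqrtD) ≡ (ℤ→ℚ z , ℤ→ℚ z)
  embed⊗[1+√d] z = cong₂ _,_
    (solve 2 (λ z D → z :* (con 1ℚ :+ con 0ℚ) :+ D :* (con 0ℚ :* (con 0ℚ :+ con 1ℚ)) := z) refl (ℤ→ℚ z) D)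
    (solve 1 (λ z → z :* (con 0ℚ :+ con 1ℚ) :+ con 0ℚ :* (con 1ℚ :+ con 0ℚ) := z) refl (ℤ→ℚ z))

  module Trace (a b : ℚ) where
    y : QF
    y = (a , b)

    t n : ℚ
    t = a ℚ.+ a
    n = norm y

    lin : ℚ × ℚ → QF
    lin (P , R) = (P ℚ.* a ℚ.+ R , P ℚ.* b)

    -- y (P y + R) + γ = (P t + R) y + (γ − P n), because y² = t y − n.
    step : ℚ → ℚ × ℚ → ℚ × ℚ
    step γ (P , R) = (P ℚ.* t ℚ.+ R , γ ℚ.- P ℚ.* n)

    horner : List ℤ → ℚ × ℚ
    horner []       = (0ℚ , 0ℚ)
    horner (c ∷ cs) = step (ℤ→ℚ c) (horner cs)

    powerCoeffs : ℕ → ℚ × ℚ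
    powerCoeffs zero    = (0ℚ , 1ℚ)
    powerCoeffs (suc k) = step 0ℚ (powerCoeffs k)

    y⊗lin : ∀ S → y ⊗ lin S ≡ lin (step 0ℚ S)
    y⊗lin (P , R) = cong₂ _,_
      (solve 5 (λ a b D P R → a :* (P :* a :+ R) :+ D :* (b :* (P :* b))
                           := (P :* (a :+ a) :+ R) :* a :+ (con 0ℚ :- P :* (a :* a :- D :* (b :* b))))
        refl a b D P R)
      (solve 4 (λ a b P R → a :* (P :* b) :+ b :* (P :* a :+ R) := (P :* (a :+ a) :+ R) :* b) refl a b P R)

    embed⊕lin : ∀ c S → embed c ⊕ lin (step 0ℚ S) ≡ lin (step (ℤ→ℚ c) S)
    embed⊕lin c (P , R) = cong₂ _,_
      (solve 4 (λ x γ y m → γ :+ (x :+ (con 0ℚ :- m)) := x :+ (γ :- m)) refl (proj₁ (step 0ℚ (P , R)) ℚ.* a) (ℤ→ℚ c) P (P ℚ.* n))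
      (ℚP.+-identityˡ _)

    evalPoly≡lin : ∀ cs → evalPoly cs y ≡ lin (horner cs)
    evalPoly≡lin []       = cong₂ _,_ (solve 1 (λ a → con 0ℚ := con 0ℚ :* a :+ con 0ℚ) refl a)
                                      (solve 1 (λ b → con 0ℚ := con 0ℚ :* b) refl b)
    evalPoly≡lin (c ∷ cs) = begin
      embed c ⊕ (y ⊗ evalPoly cs y)     ≡⟨ cong (λ x → embed c ⊕ (y ⊗ x)) (evalPoly≡lin cs) ⟩
      embed c ⊕ (y ⊗ lin (horner cs))   ≡⟨ cong (embed c ⊕_) (y⊗lin (horner cs)) ⟩
      embed c ⊕ lin (step 0ℚ (horner cs)) ≡⟨ embed⊕lin c (horner cs) ⟩
      lin (horner (c ∷ cs))             ∎
      where open ≡-Reasoning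

    ^ᴷ≡lin : ∀ k → y ^ᴷ k ≡ lin (powerCoeffs k)
    ^ᴷ≡lin zero    = cong₂ _,_ (solve 1 (λ a → con 1ℚ := con 0ℚ :* a :+ con 1ℚ) refl a)
                               (solve 1 (λ b → con 0ℚ := con 0ℚ :* b) refl b)
    ^ᴷ≡lin (suc k) = trans (cong (y ⊗_) (^ᴷ≡lin k)) (y⊗lin (powerCoeffs k))

    -- The √d-coordinate of P y + R is P b, so b ≠ 0 isolates the P-coefficients.
    monic⇒leading : b ≢ 0ℚ → ∀ cs → (y ^ᴷ length cs) ⊕ evalPoly cs y ≡ zeroQF
      → proj₁ (powerCoeffs (length cs)) ℚ.+ proj₁ (horner cs) ≡ 0ℚ
    monic⇒leading b≢0 cs root = x*y≡0⇒y≡0 b≢0 (begin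
      b ℚ.* (PA ℚ.+ PH)         ≡⟨ ℚP.*-comm b (PA ℚ.+ PH) ⟩
      (PA ℚ.+ PH) ℚ.* b         ≡⟨ ℚP.*-distribʳ-+ b PA PH ⟩
      PA ℚ.* b ℚ.+ PH ℚ.* b     ≡⟨ cong proj₂ (trans (sym (cong₂ _⊕_ (^ᴷ≡lin (length cs)) (evalPoly≡lin cs))) root) ⟩
      0ℚ                        ∎)
      where
      open ≡-Reasoning
      PA = proj₁ (powerCoeffs (length cs))
      PH = proj₁ (horner cs)

    module ClearDenominators (U V N : ℤ) .{{_ : ℤ.NonZero V}}
      (t*V≡U : t ℚ.* fromℤ V ≡ fromℤ U) (n≡N : n ≡ fromℤ N) where

      HasNumerators : ℕ → ℚ × ℚ → ℤ × ℤ → Set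
      HasNumerators j (P , R) (π , ρ) =
        fromℤ (V ℤ.^ j) ℚ.* P ≡ fromℤ V ℚ.* fromℤ π × fromℤ (V ℤ.^ j) ℚ.* R ≡ fromℤ ρ

      -- Modulo V this is π ↦ π U, as the new ρ is always a multiple of V.
      stepℤ : ℕ → ℤ → ℤ × ℤ → ℤ × ℤ
      stepℤ j c (π , ρ) = (π ℤ.* U ℤ.+ ρ , c ℤ.* V ℤ.^ suc j ℤ.- V ℤ.* (V ℤ.* (π ℤ.* N)))

      step-numerators : ∀ j c S σ → HasNumerators j S σ
        → HasNumerators (suc j) (step (fromℤ c) S) (stepℤ j c σ)
      step-numerators j c (P , R) (π , ρ) (Vʲ*P≡V*π , Vʲ*R≡ρ) = first , second
        where
        open ≡-Reasoning
        X = fromℤ (V ℤ.^ j)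
        v = fromℤ V
        first : fromℤ (V ℤ.* V ℤ.^ j) ℚ.* (P ℚ.* t ℚ.+ R) ≡ v ℚ.* fromℤ (π ℤ.* U ℤ.+ ρ)
        first = begin
          fromℤ (V ℤ.* V ℤ.^ j) ℚ.* (P ℚ.* t ℚ.+ R)
            ≡⟨ cong (ℚ._* (P ℚ.* t ℚ.+ R)) (fromℤ-homo-* V (V ℤ.^ j)) ⟩
          (v ℚ.* X) ℚ.* (P ℚ.* t ℚ.+ R)
            ≡⟨ solve 5 (λ v X P t R → (v :* X) :* (P :* t :+ R) := (X :* P) :* (t :* v) :+ v :* (X :* R)) refl v X P t R ⟩
          (X ℚ.* P) ℚ.* (t ℚ.* v) ℚ.+ v ℚ.* (X ℚ.* R)
            ≡⟨ cong₂ (λ z w → z ℚ.* w ℚ.+ v ℚ.* (X ℚ.* R)) Vʲ*P≡V*π t*V≡U ⟩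
          (v ℚ.* fromℤ π) ℚ.* fromℤ U ℚ.+ v ℚ.* (X ℚ.* R)
            ≡⟨ cong (λ z → (v ℚ.* fromℤ π) ℚ.* fromℤ U ℚ.+ v ℚ.* z) Vʲ*R≡ρ ⟩
          (v ℚ.* fromℤ π) ℚ.* fromℤ U ℚ.+ v ℚ.* fromℤ ρ
            ≡⟨ solve 4 (λ v p u r → (v :* p) :* u :+ v :* r := v :* (p :* u :+ r)) refl v (fromℤ π) (fromℤ U) (fromℤ ρ) ⟩
          v ℚ.* (fromℤ π ℚ.* fromℤ U ℚ.+ fromℤ ρ)
            ≡⟨ cong (v ℚ.*_) (sym (trans (fromℤ-homo-+ (π ℤ.* U) ρ) (cong (ℚ._+ fromℤ ρ) (fromℤ-homo-* π U)))) ⟩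
          v ℚ.* fromℤ (π ℤ.* U ℤ.+ ρ) ∎
        second : fromℤ (V ℤ.* V ℤ.^ j) ℚ.* (fromℤ c ℚ.- P ℚ.* n)
               ≡ fromℤ (c ℤ.* (V ℤ.* V ℤ.^ j) ℤ.- V ℤ.* (V ℤ.* (π ℤ.* N)))
        second = begin
          fromℤ (V ℤ.* V ℤ.^ j) ℚ.* (fromℤ c ℚ.- P ℚ.* n)
            ≡⟨ cong (ℚ._* (fromℤ c ℚ.- P ℚ.* n)) (fromℤ-homo-* V (V ℤ.^ j)) ⟩
          (v ℚ.* X) ℚ.* (fromℤ c ℚ.- P ℚ.* n)
            ≡⟨ solve 5 (λ v X c P n → (v :* X) :* (c :- P :* n) := c :* (v :* X) :- v :* ((X :* P) :* n)) refl v X (fromℤ c) P n ⟩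
          fromℤ c ℚ.* (v ℚ.* X) ℚ.- v ℚ.* ((X ℚ.* P) ℚ.* n)
            ≡⟨ cong₂ (λ z w → fromℤ c ℚ.* (v ℚ.* X) ℚ.- v ℚ.* (z ℚ.* w)) Vʲ*P≡V*π n≡N ⟩
          fromℤ c ℚ.* (v ℚ.* X) ℚ.- v ℚ.* ((v ℚ.* fromℤ π) ℚ.* fromℤ N)
            ≡⟨ cong (λ z → fromℤ c ℚ.* (v ℚ.* X) ℚ.- v ℚ.* z) (ℚP.*-assoc v (fromℤ π) (fromℤ N)) ⟩
          fromℤ c ℚ.* (v ℚ.* X) ℚ.- v ℚ.* (v ℚ.* (fromℤ π ℚ.* fromℤ N))
            ≡⟨ sym (trans (fromℤ-homo-- (c ℤ.* (V ℤ.* V ℤ.^ j)) (V ℤ.* (V ℤ.* (π ℤ.* N))))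
                   (cong₂ ℚ._-_ (trans (fromℤ-homo-* c _) (cong (fromℤ c ℚ.*_) (fromℤ-homo-* V (V ℤ.^ j))))
                                (trans (fromℤ-homo-* V _) (cong (v ℚ.*_) (trans (fromℤ-homo-* V _) (cong (v ℚ.*_) (fromℤ-homo-* π N))))))) ⟩
          fromℤ (c ℤ.* (V ℤ.* V ℤ.^ j) ℤ.- V ℤ.* (V ℤ.* (π ℤ.* N))) ∎

      V∣0 : V ℤ∣.∣ + 0
      V∣0 = ℤ∣.divides (+ 0) (sym (ℤP.*-zeroˡ V))

      V∣stepℤ₂ : ∀ j c σ → V ℤ∣.∣ proj₂ (stepℤ j c σ)
      V∣stepℤ₂ j c (π , ρ) = ℤ∣.∣m∣n⇒∣m-n (ℤ∣.∣n⇒∣m*n c (ℤ∣.∣m⇒∣m*n (V ℤ.^ j) ℤ∣.∣-refl))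
                                        (ℤ∣.∣m⇒∣m*n (V ℤ.* (π ℤ.* N)) ℤ∣.∣-refl)

      horner-numerators : ∀ cs → Σ (ℤ × ℤ) λ σ →
        HasNumerators (length cs) (horner cs) σ × V ℤ∣.∣ proj₁ σ × V ℤ∣.∣ proj₂ σ
      horner-numerators [] =
        (+ 0 , + 0) , (solve 1 (λ v → con 1ℚ :* con 0ℚ := v :* con 0ℚ) refl (fromℤ V) , ℚP.*-zeroʳ 1ℚ) , V∣0 , V∣0
      horner-numerators (c ∷ cs) with horner-numerators cs
      ... | σ@(π , ρ) , nums , V∣π , V∣ρ =
        stepℤ (length cs) c σ ,
        subst (λ γ → HasNumerators (length (c ∷ cs)) (step γ (horner cs)) (stepℤ (length cs) c σ))
              (sym (ℤ→ℚ≡fromℤ c)) (step-numerators (length cs) c (horner cs) σ nums) ,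
        ℤ∣.∣m∣n⇒∣m+n (ℤ∣.∣m⇒∣m*n U V∣π) V∣ρ ,
        V∣stepℤ₂ (length cs) c σ

      power-numerators : ∀ k → Σ (ℤ × ℤ) λ σ →
        HasNumerators (suc k) (powerCoeffs (suc k)) σ × V ℤ∣.∣ proj₁ σ ℤ.- U ℤ.^ k × V ℤ∣.∣ proj₂ σ
      power-numerators zero =
        stepℤ 0 (+ 0) (+ 0 , + 1) , step-numerators 0 (+ 0) (0ℚ , 1ℚ) (+ 0 , + 1) (solve 1 (λ v → con 1ℚ :* con 0ℚ := v :* con 0ℚ) refl (fromℤ V) , ℚP.*-identityˡ 1ℚ) ,
        subst (V ℤ∣.∣_) (ℤS.solve 1 (λ u → ℤS.con (+ 0) ℤS.:= (ℤS.con (+ 0) ℤS.:* u ℤS.:+ ℤS.con (+ 1)) ℤS.:- ℤS.con (+ 1)) refl U) V∣0 ,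
        V∣stepℤ₂ 0 (+ 0) (+ 0 , + 1)
      power-numerators (suc k) with power-numerators k
      ... | σ@(π , ρ) , nums , V∣π-Uᵏ , V∣ρ =
        stepℤ (suc k) (+ 0) σ ,
        step-numerators (suc k) (+ 0) (powerCoeffs (suc k)) σ nums ,
        subst (V ℤ∣.∣_) (ℤS.solve 4 (λ π u w ρ → (π ℤS.:- w) ℤS.:* u ℤS.:+ ρ ℤS.:= (π ℤS.:* u ℤS.:+ ρ) ℤS.:- u ℤS.:* w) refl π U (U ℤ.^ k) ρ)
              (ℤ∣.∣m∣n⇒∣m+n (ℤ∣.∣m⇒∣m*n U V∣π-Uᵏ) V∣ρ) ,
        V∣stepℤ₂ (suc k) (+ 0) σ

      numerators-sum≡0 : ∀ j P Q {π ρ} → fromℤ (V ℤ.^ j) ℚ.* P ≡ fromℤ V ℚ.* fromℤ π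
        → fromℤ (V ℤ.^ j) ℚ.* Q ≡ fromℤ V ℚ.* fromℤ ρ → P ℚ.+ Q ≡ 0ℚ → π ℤ.+ ρ ≡ + 0
      numerators-sum≡0 j P Q {π} {ρ} Vʲ*P≡V*π Vʲ*Q≡V*ρ P+Q≡0 =
        ℤP.*-cancelˡ-≡ V (π ℤ.+ ρ) (+ 0) (trans (fromℤ-injective (begin
          fromℤ (V ℤ.* (π ℤ.+ ρ))                         ≡⟨ trans (fromℤ-homo-* V (π ℤ.+ ρ)) (cong (fromℤ V ℚ.*_) (fromℤ-homo-+ π ρ)) ⟩
          fromℤ V ℚ.* (fromℤ π ℚ.+ fromℤ ρ)               ≡⟨ ℚP.*-distribˡ-+ (fromℤ V) (fromℤ π) (fromℤ ρ) ⟩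
          fromℤ V ℚ.* fromℤ π ℚ.+ fromℤ V ℚ.* fromℤ ρ     ≡⟨ sym (cong₂ ℚ._+_ Vʲ*P≡V*π Vʲ*Q≡V*ρ) ⟩
          fromℤ (V ℤ.^ j) ℚ.* P ℚ.+ fromℤ (V ℤ.^ j) ℚ.* Q ≡⟨ sym (ℚP.*-distribˡ-+ (fromℤ (V ℤ.^ j)) P Q) ⟩
          fromℤ (V ℤ.^ j) ℚ.* (P ℚ.+ Q)                   ≡⟨ cong (fromℤ (V ℤ.^ j) ℚ.*_) P+Q≡0 ⟩
          fromℤ (V ℤ.^ j) ℚ.* 0ℚ                          ≡⟨ ℚP.*-zeroʳ (fromℤ (V ℤ.^ j)) ⟩
          fromℤ (+ 0)                                     ∎)) (sym (ℤP.*-zeroʳ V)))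
        where open ≡-Reasoning

      V∣U^k : ∀ c cs → proj₁ (powerCoeffs (length (c ∷ cs))) ℚ.+ proj₁ (horner (c ∷ cs)) ≡ 0ℚ
        → V ℤ∣.∣ U ℤ.^ length cs
      V∣U^k c cs PA+PH≡0 =
        let (πA , _) , (Vʲ*PA≡V*πA , _) , V∣πA-Uᵏ , _ = power-numerators (length cs)
            (πH , _) , (Vʲ*PH≡V*πH , _) , V∣πH , _ = horner-numerators (c ∷ cs)
            πA+πH≡0 = numerators-sum≡0 (length (c ∷ cs)) (proj₁ (powerCoeffs (length (c ∷ cs)))) (proj₁ (horner (c ∷ cs)))
                        Vʲ*PA≡V*πA Vʲ*PH≡V*πH PA+PH≡0
            V∣πA = ℤ∣.∣m+n∣n⇒∣m {V} {πA} {πH} (subst (V ℤ∣.∣_) (sym πA+πH≡0) V∣0) V∣πH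
        in subst (V ℤ∣.∣_) (ℤS.solve 2 (λ a w → a ℤS.:- (a ℤS.:- w) ℤS.:= w) refl πA (U ℤ.^ length cs))
                 (ℤ∣.∣m∣n⇒∣m-n {V} {πA} {πA ℤ.- U ℤ.^ length cs} V∣πA V∣πA-Uᵏ)

    trace-integral : ∀ N → n ≡ fromℤ N → b ≢ 0ℚ → IsAlgebraicInteger y → t ≡ fromℤ (↥ t)
    trace-integral N n≡N b≢0 ([] , 1≡0) =
      ⊥-elim (ℚP.1≢0 (trans (sym (ℚP.+-identityʳ 1ℚ)) (cong proj₁ 1≡0)))
    trace-integral N n≡N b≢0 (c ∷ cs , root) = ↧∣↥^n⇒integral t (length cs)
      (ClearDenominators.V∣U^k (↥ t) (↧ t) N (r*↧r≡↥r t) n≡N c cs (monic⇒leading b≢0 (c ∷ cs) root))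

  -- A p-th root a + b√d has norm M and integral trace 2a, so w (2b)² + (2a)² = 4M with b ≠ 0.
  no-pth-root : ∀ {w M} p .{{_ : ℕ.NonZero p}} → D ≡ ℚ.- fromℤ (+ w) → SquareFree w → 4 ℕ.* M < w
    → ∀ {x} → proj₂ x ≢ 0ℚ → norm x ≡ fromℤ (+ M) ^ᵠ p → ¬ IsPthPowerInOK p x
  no-pth-root {w} {M} (suc p-1) D≡-w sf 4M<w {x} x₂≢0 Nx≡Mᵖ ((a , b) , y-integral , yᵖ≡x)
    with b ℚ.≟ 0ℚ
  ... | yes refl = x₂≢0 (trans (sym (cong proj₂ yᵖ≡x)) (rational-^ᴷ a (suc p-1)))
  ... | no b≢0 = ℕP.<⇒≱ 4M<w (squareFree-bound (b ℚ.+ b) (↥ t) sf 2b≢0 w[2b]²+t²≡4M)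
    where
    open Trace a b
    open ≡-Reasoning
    D≤0 : D ℚ.≤ 0ℚ
    D≤0 = subst (ℚ._≤ 0ℚ) (sym D≡-w) (ℚP.neg-antimono-≤ (ℚP.nonNegative⁻¹ (fromℤ (+ w))))
    n≡M : n ≡ fromℤ (+ M)
    n≡M = ^-cancelˡ-≡-nonNeg p-1 (norm-nonNeg D≤0 y) (ℚP.nonNegative⁻¹ (fromℤ (+ M)))
      (trans (sym (norm-homo-^ᴷ y (suc p-1))) (trans (cong norm yᵖ≡x) Nx≡Mᵖ))
    2b≢0 : b ℚ.+ b ≢ 0ℚ
    2b≢0 2b≡0 = b≢0 (x*y≡0⇒y≡0 {fromℤ (+ 2)} (λ ())
      (trans (solve 1 (λ b → con (fromℤ (+ 2)) :* b := b :+ b) refl b) 2b≡0))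
    w[2b]²+t²≡4M : fromℤ (+ w) ℚ.* ((b ℚ.+ b) ℚ.* (b ℚ.+ b)) ℚ.+ fromℤ (↥ t) ℚ.* fromℤ (↥ t) ≡ fromℤ (+ (4 ℕ.* M))
    w[2b]²+t²≡4M = begin
      fromℤ (+ w) ℚ.* ((b ℚ.+ b) ℚ.* (b ℚ.+ b)) ℚ.+ fromℤ (↥ t) ℚ.* fromℤ (↥ t)
        ≡⟨ cong (λ u → fromℤ (+ w) ℚ.* ((b ℚ.+ b) ℚ.* (b ℚ.+ b)) ℚ.+ u ℚ.* u) (sym (trace-integral (+ M) n≡M b≢0 y-integral)) ⟩
      fromℤ (+ w) ℚ.* ((b ℚ.+ b) ℚ.* (b ℚ.+ b)) ℚ.+ (a ℚ.+ a) ℚ.* (a ℚ.+ a)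
        ≡⟨ solve 3 (λ a b w → w :* ((b :+ b) :* (b :+ b)) :+ (a :+ a) :* (a :+ a)
                           := con (fromℤ (+ 4)) :* (a :* a :- (:- w) :* (b :* b))) refl a b (fromℤ (+ w)) ⟩
      fromℤ (+ 4) ℚ.* (a ℚ.* a ℚ.- ℚ.- fromℤ (+ w) ℚ.* (b ℚ.* b))
        ≡⟨ cong (λ δ → fromℤ (+ 4) ℚ.* (a ℚ.* a ℚ.- δ ℚ.* (b ℚ.* b))) (sym D≡-w) ⟩
      fromℤ (+ 4) ℚ.* n
        ≡⟨ trans (cong (fromℤ (+ 4) ℚ.*_) n≡M) (sym (fromℕ-homo-* 4 M)) ⟩
      fromℤ (+ (4 ℕ.* M)) ∎

odd-prime⇒3≤p : ∀ {p} → Prime p → ¬ 2 ∣ p → 3 ≤ p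
odd-prime⇒3≤p {p} p-prime 2∤p with ℕP.m≤n⇒m<n∨m≡n (ℕ.nonTrivial⇒n>1 p {{prime⇒nonTrivial p-prime}})
... | inj₁ 2<p  = 2<p
... | inj₂ refl = ⊥-elim (2∤p ℕ∣.∣-refl)

odd⇒≡1+2[n∸1/2] : ∀ n → ¬ 2 ∣ n → n ≡ suc ((n ∸ 1) / 2 ℕ.+ (n ∸ 1) / 2)
odd⇒≡1+2[n∸1/2] n 2∤n = begin
  n                        ≡⟨ ℕDM.m≡m%n+[m/n]*n n 2 ⟩
  n % 2 ℕ.+ n / 2 ℕ.* 2    ≡⟨ cong (ℕ._+ n / 2 ℕ.* 2) n%2≡1 ⟩
  suc (n / 2 ℕ.* 2)        ≡⟨ cong suc (trans (ℕP.*-comm (n / 2) 2) (cong (n / 2 ℕ.+_) (ℕP.+-identityʳ (n / 2)))) ⟩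
  suc (n / 2 ℕ.+ n / 2)    ≡⟨ cong (λ k → suc (k ℕ.+ k)) (sym [n∸1]/2≡n/2) ⟩
  suc ((n ∸ 1) / 2 ℕ.+ (n ∸ 1) / 2) ∎
  where
  open ≡-Reasoning
  n%2≡1 : n % 2 ≡ 1
  n%2≡1 with n % 2 | ℕDM.m%n<n n 2 | ℕ∣.m%n≡0⇒n∣m n 2
  ... | 0           | _                    | 2∣n = ⊥-elim (2∤n (2∣n refl))
  ... | 1           | _                    | _   = refl
  ... | suc (suc _) | ℕ.s≤s (ℕ.s≤s ())   | _
  [n∸1]/2≡n/2 : (n ∸ 1) / 2 ≡ n / 2
  [n∸1]/2≡n/2 = trans (cong (λ k → (k ∸ 1) / 2) (trans (ℕDM.m≡m%n+[m/n]*n n 2) (cong (ℕ._+ n / 2 ℕ.* 2) n%2≡1)))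
                      (ℕDM.m*n/n≡m (n / 2) 2)

8m<2mᵖ-1 : ∀ {m p} → 3 ≤ m → 3 ≤ p → 4 ℕ.* (2 ℕ.* m) < 2 ℕ.* m ^ p ∸ 1
8m<2mᵖ-1 {m} {p} 3≤m 3≤p = ℕP.m+n≤o⇒m≤o∸n (suc (4 ℕ.* (2 ℕ.* m))) (begin
  suc (4 ℕ.* (2 ℕ.* m)) ℕ.+ 1  ≡⟨ ℕS.solve 1 (λ m → ℕS.con 1 ℕS.:+ ℕS.con 4 ℕS.:* (ℕS.con 2 ℕS.:* m) ℕS.:+ ℕS.con 1
                                                  ℕS.:= ℕS.con 2 ℕS.:* (ℕS.con 4 ℕS.:* m ℕS.:+ ℕS.con 1)) refl m ⟩
  2 ℕ.* (4 ℕ.* m ℕ.+ 1)          ≤⟨ ℕP.*-monoʳ-≤ 2 (ℕP.+-monoʳ-≤ (4 ℕ.* m) (ℕP.≤-trans (ℕ.s≤s ℕ.z≤n) (ℕP.*-monoʳ-≤ 5 3≤m))) ⟩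
  2 ℕ.* (4 ℕ.* m ℕ.+ 5 ℕ.* m)    ≡⟨ cong (2 ℕ.*_) (ℕS.solve 1 (λ m → ℕS.con 4 ℕS.:* m ℕS.:+ ℕS.con 5 ℕS.:* m
                                                  ℕS.:= ℕS.con 3 ℕS.:* (ℕS.con 3 ℕS.:* (m ℕS.:* ℕS.con 1))) refl m) ⟩
  2 ℕ.* (3 ℕ.* (3 ℕ.* (m ℕ.* 1))) ≤⟨ ℕP.*-monoʳ-≤ 2 (ℕP.*-mono-≤ 3≤m (ℕP.*-mono-≤ 3≤m ℕP.≤-refl)) ⟩
  2 ℕ.* (m ℕ.* (m ℕ.* (m ℕ.* 1))) ≤⟨ ℕP.*-monoʳ-≤ 2 (ℕP.^-monoʳ-≤ m {{ℕ.>-nonZero (ℕP.≤-trans (ℕ.s≤s ℕ.z≤n) 3≤m)}} 3≤p) ⟩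
  2 ℕ.* m ^ p                   ∎)
  where open ℕP.≤-Reasoning

module ℚ[√1-2mᵖ] (m p : ℕ) where
  δ w : ℕ
  δ = 2 ℕ.* m ^ p
  w = δ ∸ 1

  open QuadField (+ 1 ℤ.- + δ)
  open QuadraticField (+ 1 ℤ.- + δ)

  1-D≡δ : 1ℚ ℚ.- D ≡ fromℤ (+ δ)
  1-D≡δ = begin
    1ℚ ℚ.- D                               ≡⟨ cong (λ x → 1ℚ ℚ.- x) (trans (ℤ→ℚ≡fromℤ _) (fromℤ-homo-- (+ 1) (+ δ))) ⟩
    1ℚ ℚ.- (1ℚ ℚ.- fromℤ (+ δ))            ≡⟨ solve 1 (λ x → con 1ℚ :- (con 1ℚ :- x) := x) refl (fromℤ (+ δ)) ⟩
    fromℤ (+ δ)                            ∎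
    where
    open ≡-Reasoning
    open ℚS

  D≡-w : .{{ℕ.NonZero m}} → D ≡ ℚ.- fromℤ (+ w)
  D≡-w = begin
    D                            ≡⟨ ℚS.solve 1 (λ D → D ℚS.:= ℚS.con 1ℚ ℚS.:- (ℚS.con 1ℚ ℚS.:- D)) refl D ⟩
    1ℚ ℚ.- (1ℚ ℚ.- D)            ≡⟨ cong (λ x → 1ℚ ℚ.- x) 1-D≡δ ⟩
    1ℚ ℚ.- fromℤ (+ δ)           ≡⟨ cong (λ x → 1ℚ ℚ.- fromℤ (+ x)) (sym (ℕP.m+[n∸m]≡n 1≤δ)) ⟩
    1ℚ ℚ.- fromℤ (+ 1 ℤ.+ + w)   ≡⟨ cong (λ x → 1ℚ ℚ.- x) (fromℤ-homo-+ (+ 1) (+ w)) ⟩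
    1ℚ ℚ.- (1ℚ ℚ.+ fromℤ (+ w))  ≡⟨ ℚS.solve 1 (λ x → ℚS.con 1ℚ ℚS.:- (ℚS.con 1ℚ ℚS.:+ x) ℚS.:= ℚS.:- x) refl (fromℤ (+ w)) ⟩
    ℚ.- fromℤ (+ w)              ∎
    where
    open ≡-Reasoning
    1≤δ : 1 ≤ δ
    1≤δ = ℕP.≤-trans (ℕP.m^n>0 m p) (ℕP.m≤n*m (m ^ p) 2)

  norm-2ᵏ[1+√d] : ∀ k → p ≡ suc (k ℕ.+ k) → norm (ℤ→ℚ (+ (2 ^ k)) , ℤ→ℚ (+ (2 ^ k))) ≡ fromℤ (+ (2 ℕ.* m)) ^ᵠ p
  norm-2ᵏ[1+√d] k p≡1+2k = begin
    Z ℚ.* Z ℚ.- D ℚ.* (Z ℚ.* Z)                ≡⟨ solve 2 (λ z D → z :* z :- D :* (z :* z) := (z :* z) :* (con 1ℚ :- D)) refl Z D ⟩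
    (Z ℚ.* Z) ℚ.* (1ℚ ℚ.- D)                   ≡⟨ cong₂ (λ z x → (z ℚ.* z) ℚ.* x) Z≡2ᵏ (trans 1-D≡δ (fromℕ-homo-* 2 (m ^ p))) ⟩
    (two ^ᵠ k ℚ.* two ^ᵠ k) ℚ.* (two ℚ.* fromℤ (+ (m ^ p)))
      ≡⟨ solve 4 (λ a b t u → (a :* b) :* (t :* u) := (t :* (a :* b)) :* u) refl (two ^ᵠ k) (two ^ᵠ k) two (fromℤ (+ (m ^ p))) ⟩
    (two ℚ.* (two ^ᵠ k ℚ.* two ^ᵠ k)) ℚ.* fromℤ (+ (m ^ p))
      ≡⟨ cong₂ (λ x y → (two ℚ.* x) ℚ.* y) (sym (^-homo-* two k k)) (fromℕ-homo-^ m p) ⟩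
    two ^ᵠ suc (k ℕ.+ k) ℚ.* fromℤ (+ m) ^ᵠ p    ≡⟨ cong (λ e → two ^ᵠ e ℚ.* fromℤ (+ m) ^ᵠ p) (sym p≡1+2k) ⟩
    two ^ᵠ p ℚ.* fromℤ (+ m) ^ᵠ p                ≡⟨ sym (^-distrib-* two (fromℤ (+ m)) p) ⟩
    (two ℚ.* fromℤ (+ m)) ^ᵠ p                  ≡⟨ cong (_^ᵠ p) (sym (fromℕ-homo-* 2 m)) ⟩
    fromℤ (+ (2 ℕ.* m)) ^ᵠ p                    ∎
    where
    open ≡-Reasoning
    open ℚS
    two = fromℤ (+ 2)
    Z = ℤ→ℚ (+ (2 ^ k))
    Z≡2ᵏ : Z ≡ two ^ᵠ k
    Z≡2ᵏ = trans (ℤ→ℚ≡fromℤ _) (fromℕ-homo-^ 2 k)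

proposition22 : (m p : ℕ) → 3 ≤ m → ¬ (2 ∣ m) → Prime p → ¬ (2 ∣ p)
    → SquareFree ((2 ℕ.* (m ^ p)) ∸ 1)
    → let open QuadField ((+ 1) ℤ.- (+ (2 ℕ.* (m ^ p))))
          c = embed (+ (2 ^ ((p ∸ 1) / 2))) ⊗ (oneQF ⊕ sqrtD)
      in ¬ IsPthPowerInOK p c × ¬ IsPthPowerInOK p (⊖ c)
proposition22 m p 3≤m _ p-prime 2∤p sf =
  no-root (embed⊗[1+√d] (+ 2ᵏ)) 2ᵏ≢0 N[2ᵏ,2ᵏ]≡[2m]ᵖ ,
  no-root (cong ⊖_ (embed⊗[1+√d] (+ 2ᵏ))) (λ -2ᵏ≡0 → 2ᵏ≢0 (ℚP.neg-injective -2ᵏ≡0))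
          (trans (norm-⊖ (Z , Z)) N[2ᵏ,2ᵏ]≡[2m]ᵖ)
  where
  instance
    _ = prime⇒nonZero p-prime
    _ = ℕ.>-nonZero (ℕP.≤-trans (ℕ.s≤s ℕ.z≤n) 3≤m)
  k = (p ∸ 1) / 2
  2ᵏ = 2 ^ k
  open QuadField (+ 1 ℤ.- + (2 ℕ.* m ^ p))
  open QuadraticField (+ 1 ℤ.- + (2 ℕ.* m ^ p))
  open ℚ[√1-2mᵖ] m p
  Z = ℤ→ℚ (+ 2ᵏ)
  2ᵏ≢0 : Z ≢ 0ℚ
  2ᵏ≢0 Z≡0 = ℕ.≢-nonZero⁻¹ 2ᵏ {{ℕP.m^n≢0 2 k}} (ℤP.+-injective (fromℤ-injective (trans (sym (ℤ→ℚ≡fromℤ (+ 2ᵏ))) Z≡0)))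
  N[2ᵏ,2ᵏ]≡[2m]ᵖ : norm (Z , Z) ≡ fromℤ (+ (2 ℕ.* m)) ^ᵠ p
  N[2ᵏ,2ᵏ]≡[2m]ᵖ = norm-2ᵏ[1+√d] k (odd⇒≡1+2[n∸1/2] p 2∤p)
  no-root : ∀ {c x} → c ≡ x → proj₂ x ≢ 0ℚ → norm x ≡ fromℤ (+ (2 ℕ.* m)) ^ᵠ p → ¬ IsPthPowerInOK p c
  no-root refl = no-pth-root p D≡-w sf (8m<2mᵖ-1 3≤m (odd-prime⇒3≤p p-prime 2∤p))
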